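{- Let $P$ be a Schröder path and let $(x,z)\in\mathbb{Z}^2$ be a point on $P$ with $z>x+1$ such that the bounce path of $P$ at $(x,z)$ has exactly one bounce point and the bounce decomposition of $P$ at $(x,z)$ is $P=U\mathtt{n}\cdot\mathtt{n}V\mathtt{d}\cdot\mathtt{e}W$. Then $\mathrm{G}_P(\mathbf{x};q)=q\,\mathrm{G}_{U\mathtt{n}\mathtt{n}V\mathtt{e}\mathtt{d}W}(\mathbf{x};q)$.
   Context: Steps: $\mathtt{n}=(0,1)$, $\mathtt{e}=(1,0)$, $\mathtt{d}=(1,1)$. A Schröder path of size $n$ is a lattice path from $(0,0)$ to $(n,n)$ with steps in $\{\mathtt{n},\mathtt{e},\mathtt{d}\}$ such that every east and every diagonal step is preceded by strictly more north steps than east steps; paths are words in $\{\mathtt{n},\mathtt{d},\mathtt{e}\}^*$. Bounce path of $P$ (size $n$) at a lattice point $(u_1,u_0)$ on $P$: move south from $(u_1,u_0)$ to $(u_1,u_1)$, then west until first reaching a point $(u_2,u_1)$ of $P$; if that point lies between two diagonal steps of $P$, continue south to $(u_2,u_2)$ and west to a point $(u_3,u_2)$ of $P$, and so on, stopping at the first point $(u_{k+1},u_k)$ incident to a north or east step of $P$. The points $(u_i,u_i)$ are the bounce points. The bounce decomposition at $(u_1,u_0)$ is the unique factorisation $P=Us_1\cdot s_2Vs_3\cdot s_4W$ ($s_i$ single steps) where $Us_1$ is the part of $P$ from $(0,0)$ to $(u_{k+1},u_k)$ and $s_4W$ is the part from $(u_1,u_0)$ to $(n,n)$; dots are only markers.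 $\Gamma_P$ is the graph on $[n]$ where, for $1\le a<b\le n$, $\{a,b\}$ is a non-strict edge if the unit square $[a-1,a]\times[b-1,b]$ lies in the region between $P$ and the line $y=x$, and a strict edge if $P$ has a diagonal step from $(a-1,b-1)$ to $(a,b)$. A coloring is a map $\kappa:[n]\to\mathbb{Z}_{>0}$ with $\kappa(a)<\kappa(b)$ for each strict edge $\{a,b\}$, $a<b$; $\mathrm{asc}(\kappa)$ is the number of non-strict edges $\{a,b\}$, $a<b$, with $\kappa(a)<\kappa(b)$. $\mathrm{G}_P(\mathbf{x};q)=\sum_\kappa q^{\mathrm{asc}(\kappa)}x_{\kappa(1)}\cdots x_{\kappa(n)}$ over all colorings. -}

module Defs where

open import Data.Nat using (ℕ; zero; suc; _+_; _<_; _≤_; _<ᵇ_; _≡ᵇ_)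
open import Data.Nat.Properties using (_≟_)
open import Data.Bool using (Bool; true; false; _∧_; _∨_; if_then_else_)
open import Data.Fin using (Fin; toℕ)
open import Data.List using (List; []; _∷_; _++_; [_]; length; map; concatMap; filter; foldr; allFin)
open import Data.Vec using (Vec; []; _∷_; replicate; updateAt; lookup)
import Data.Vec.Properties as VecP
open import Data.Product using (_×_; _,_; Σ; ∃; ∃-syntax)
open import Data.Sum using (_⊎_)
open import Data.List.Membership.Propositional using (_∈_)
open import Relation.Binary.PropositionalEquality using (_≡_; _≢_)
open import Relation.Nullary.Decidable using (⌊_⌋)

data Step : Set where
  n e d : Step     -- n = (0,1), e = (1,0), d = (1,1)

Path : Set
Path = List Step

move : Step → ℕ × ℕ → ℕ × ℕ
move n (x , y) = x , suc y
move e (x , y) = suc x , y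
move d (x , y) = suc x , suc y

endFrom : ℕ × ℕ → Path → ℕ × ℕ
endFrom p []       = p
endFrom p (s ∷ ss) = endFrom (move s p) ss

endpoint : Path → ℕ × ℕ
endpoint = endFrom (0 , 0)

pointsFrom : ℕ × ℕ → Path → List (ℕ × ℕ)
pointsFrom p []       = p ∷ []
pointsFrom p (s ∷ ss) = p ∷ pointsFrom (move s p) ss

points : Path → List (ℕ × ℕ)
points = pointsFrom (0 , 0)

isStep : Step → Step → Bool
isStep n n = true
isStep e e = true
isStep d d = true
isStep _ _ = false

count : Step → Path → ℕ
count s = foldr (λ t k → if isStep s t then suc k else k) 0

record Schroder (k : ℕ) (P : Path) : Set where
  field
    ends     : endpoint P ≡ (k , k)
    ballot   : ∀ (U : Path) (s : Step) (W : Path) → P ≡ U ++ s ∷ W →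
               s ≢ n → count e U < count n U

-- Moving west from (x,x) along the line y = x, the first point of P reached
-- is (u , x).
FirstWest : Path → ℕ → ℕ → Set
FirstWest P x u =
  ((u , x) ∈ points P) × u ≤ x ×
  (∀ t → (t , x) ∈ points P → t ≤ x → t ≤ u)

NE : Step → Set
NE s = (s ≡ n) ⊎ (s ≡ e)

IncidentNE : Path → ℕ × ℕ → Set
IncidentNE P p =
  ∃[ U ] ∃[ s ] ∃[ W ] (P ≡ U ++ s ∷ W × NE s ×
     ((endpoint U ≡ p) ⊎ (endpoint (U ++ [ s ]) ≡ p)))

-- The bounce path of P at (x , z) has exactly one bounce point (x,x):
-- the point (u , x) first reached going west from (x,x) is incident to a
-- north or east step of P, so the bounce path stops there.
OneBounce : Path → ℕ → ℕ → ℕ → Set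
OneBounce P x z u = FirstWest P x u × IncidentNE P (u , x)

-- Bounce decomposition P = U s1 · s2 V s3 · s4 W at (x , z), in the
-- one-bounce case where the bounce path stops at (u , x):
-- U s1 runs from (0,0) to (u , x) and s4 W runs from (x , z) to the end.
BounceDecomp : Path → ℕ → ℕ → ℕ →
               Path → Step → Step → Path → Step → Step → Path → Set
BounceDecomp P x z u U s1 s2 V s3 s4 W =
  (P ≡ U ++ s1 ∷ s2 ∷ V ++ s3 ∷ s4 ∷ W) ×
  (endpoint (U ++ [ s1 ]) ≡ (u , x)) ×
  (endpoint (U ++ s1 ∷ s2 ∷ V ++ [ s3 ]) ≡ (x , z))

-- The graph Γ_P (vertices 0-indexed: vertex a ∈ Fin k stands for a+1 ∈ [k])

stepsFrom : ℕ × ℕ → Path → List (Step × ℕ × ℕ)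
stepsFrom p []       = []
stepsFrom p (s ∷ ss) = (s , p) ∷ stepsFrom (move s p) ss

steps : Path → List (Step × ℕ × ℕ)
steps = stepsFrom (0 , 0)

any : {A : Set} → (A → Bool) → List A → Bool
any f = foldr (λ a b → f a ∨ b) false

isED : Step → Bool
isED n = false
isED e = true
isED d = true

-- 0-indexed a < b: the unit square [a,a+1]×[b,b+1] lies in the region
-- between P and y = x, i.e. the (east or diagonal) step of P crossing the
-- column [a,a+1] starts at height h with b + 1 ≤ h.
nonStrictEdge : Path → ℕ → ℕ → Bool
nonStrictEdge P a b =
  (a <ᵇ b) ∧ any (λ { (s , x , y) → isED s ∧ (x ≡ᵇ a) ∧ (b <ᵇ y) }) (steps P)

strictEdge : Path → ℕ → ℕ → Bool
strictEdge P a b =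
  (a <ᵇ b) ∧ any (λ { (s , x , y) → isStep d s ∧ (x ≡ᵇ a) ∧ (y ≡ᵇ b) }) (steps P)

-- Colorings with colours in Fin m (colour c stands for the variable x_{c+1})

allVecs : (m k : ℕ) → List (Vec (Fin m) k)
allVecs m zero    = [] ∷ []
allVecs m (suc k) = concatMap (λ c → map (c ∷_) (allVecs m k)) (allFin m)

pairs : (k : ℕ) → List (Fin k × Fin k)
pairs k = concatMap (λ a → map (a ,_) (allFin k)) (allFin k)

all : {A : Set} → (A → Bool) → List A → Bool
all f = foldr (λ a b → f a ∧ b) true

lt : {m : ℕ} → Fin m → Fin m → Bool
lt i j = toℕ i <ᵇ toℕ j

isColoring : {m k : ℕ} → Path → Vec (Fin m) k → Bool
isColoring {k = k} P κ =
  all (λ { (a , b) → if strictEdge P (toℕ a) (toℕ b)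
                       then lt (lookup κ a) (lookup κ b) else true })
      (pairs k)

countB : {A : Set} → (A → Bool) → List A → ℕ
countB f = foldr (λ a k → if f a then suc k else k) 0

asc : {m k : ℕ} → Path → Vec (Fin m) k → ℕ
asc {k = k} P κ =
  countB (λ { (a , b) → nonStrictEdge P (toℕ a) (toℕ b)
                        ∧ lt (lookup κ a) (lookup κ b) })
         (pairs k)

content : {m k : ℕ} → Vec (Fin m) k → Vec ℕ m
content {m} []      = replicate m 0
content (c ∷ κ)     = updateAt (content κ) c suc

_≟v_ : {m : ℕ} → (α β : Vec ℕ m) → Bool
α ≟v β = ⌊ VecP.≡-dec _≟_ α β ⌋

-- coeffG k P m α j = coefficient of  x_1^{α_1} ⋯ x_m^{α_m} q^j  in G_P(x;q),
-- where P has size k (every coloring with this content uses only colours ≤ m).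
coeffG : (k : ℕ) → Path → (m : ℕ) → Vec ℕ m → ℕ → ℕ
coeffG k P m α j =
  countB (λ κ → isColoring P κ ∧ (content κ ≟v α) ∧ (asc P κ ≡ᵇ j))
         (allVecs m k)

-- G_P(x;q) = q · G_Q(x;q)  (for P, Q of size k), coefficientwise.
GEqQTimes : ℕ → Path → Path → Set
GEqQTimes k P Q =
  ∀ (m : ℕ) (α : Vec ℕ m) →
    (coeffG k P m α 0 ≡ 0) × (∀ j → coeffG k P m α (suc j) ≡ coeffG k Q m α j)

module Submission where

-- Theorem 4.4.  Write x = X+1, z = C+1: U ends at (u , X), V runs from (u , X+2)
-- to (X , C), W from (X+2 , C+1) to (k , k), and Q = U n n V e d W.  Only the
-- columns X, X+1 of Γ differ (0-indexed vertices): column X has the non-strict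
-- edges X < b < C in both paths; P has the strict edge {X , C} and the non-strict
-- edges X+1 < b ≤ C, Q the strict edge {X+1 , C} and the non-strict edges
-- X+1 < b < C.  Apart from these columns, rows X and X+1 look alike in P and Q.
-- Bijection: keep a colour vector κ if [κ(X) < κ(C)] = [κ(X+1) < κ(C)], else
-- exchange its entries X and X+1.  This swap-invariant involution preserves the
-- content, maps P-colourings onto Q-colourings, and lowers asc by exactly one
-- (the lost ascent is {X+1 , C} for kept, {X , X+1} for swapped vectors).

open import Defs
open import Data.Nat using (ℕ; zero; suc; _+_; _<_; _≤_; _<ᵇ_; _≡ᵇ_; s≤s; _<?_)
open import Data.Nat.Properties
open import Data.Bool using (Bool; true; false; _∧_; _∨_; not; _xor_; if_then_else_; T)
open import Data.Bool.Properties using (∧-zeroʳ; ∨-identityʳ; ∨-assoc; ∨-comm; xor-comm)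
open import Data.Fin using (Fin; toℕ; fromℕ<) renaming (zero to fzero; suc to fsuc)
import Data.Fin as Fin
open import Data.Fin.Properties using (toℕ-injective; toℕ-fromℕ<)
import Data.Fin.Permutation as Perm
import Data.Fin.Permutation.Components as PermC
open import Data.List using (List; []; _∷_; _++_; [_]; map; concatMap; tabulate; allFin)
open import Data.List.Membership.Propositional using (_∈_)
open import Data.List.Membership.Propositional.Properties using (∈-concatMap⁺; ∈-map⁺; ∈-allFin)
import Data.List.Relation.Unary.Any as Any
open import Data.List.Relation.Unary.All as All using (All; []; _∷_)
open import Data.Vec using (Vec; []; _∷_; lookup; updateAt)
open import Data.Vec.Properties using (updateAt-commutes)
open import Data.Product using (Σ; _×_; _,_; proj₁; proj₂)
open import Data.Sum using (_⊎_; inj₁; inj₂; [_,_]′)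
open import Data.Empty using (⊥; ⊥-elim)
open import Function using (_∘_)
open import Relation.Binary using (tri<; tri≈; tri>)
open import Relation.Binary.PropositionalEquality hiding ([_])
open import Relation.Nullary using (yes; no)
open import Relation.Nullary.Decidable using (dec-true; dec-false)
open import Algebra.Properties.CommutativeMonoid.Sum +-0-commutativeMonoid

<⇒<ᵇ-true : ∀ {a b} → a < b → (a <ᵇ b) ≡ true
<⇒<ᵇ-true {a} {b} = dec-true (a <? b)

≤⇒<ᵇ-false : ∀ {a b} → b ≤ a → (a <ᵇ b) ≡ false
≤⇒<ᵇ-false {a} {b} b≤a = dec-false (a <? b) (≤⇒≯ b≤a)

≡ᵇ-refl : ∀ a → (a ≡ᵇ a) ≡ true
≡ᵇ-refl a = dec-true (a ≟ a) refl

≢⇒≡ᵇ-false : ∀ {a b} → a ≢ b → (a ≡ᵇ b) ≡ false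
≢⇒≡ᵇ-false {a} {b} = dec-false (a ≟ b)

true-and-false : ∀ {b} → b ≡ true → b ≡ false → ⊥
true-and-false refl ()

∧-true⇒right : ∀ {a b} → (a ∧ b) ≡ true → b ≡ true
∧-true⇒right {true} eq = eq

≡ᵇ-true⇒≡ : ∀ {a b} → (a ≡ᵇ b) ≡ true → a ≡ b
≡ᵇ-true⇒≡ {a} {b} eq = ≡ᵇ⇒≡ a b (subst T (sym eq) _)

<ᵇ-true⇒< : ∀ {a b} → (a <ᵇ b) ≡ true → a < b
<ᵇ-true⇒< eq = ≰⇒> (λ b≤a → true-and-false eq (≤⇒<ᵇ-false b≤a))

<ᵇ-false⇒≥ : ∀ {a b} → (a <ᵇ b) ≡ false → b ≤ a
<ᵇ-false⇒≥ eq = ≮⇒≥ (λ a<b → true-and-false (<⇒<ᵇ-true a<b) eq)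

<ᵇ-suc-right : ∀ {b c} → b ≢ c → (b <ᵇ suc c) ≡ (b <ᵇ c)
<ᵇ-suc-right {b} {c} b≢c with <-cmp b c
... | tri< b<c _ _ = trans (<⇒<ᵇ-true (m<n⇒m<1+n b<c)) (sym (<⇒<ᵇ-true b<c))
... | tri≈ _ b≡c _ = ⊥-elim (b≢c b≡c)
... | tri> _ _ c<b = trans (≤⇒<ᵇ-false c<b) (sym (≤⇒<ᵇ-false (<⇒≤ c<b)))

<ᵇ-suc-left : ∀ {r h} → h ≢ suc r → (r <ᵇ h) ≡ (suc r <ᵇ h)
<ᵇ-suc-left {r} {h} h≢1+r with <-cmp (suc r) h
... | tri< 1+r<h _ _ = trans (<⇒<ᵇ-true (<-trans (n<1+n r) 1+r<h)) (sym (<⇒<ᵇ-true 1+r<h))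
... | tri≈ _ eq _ = ⊥-elim (h≢1+r (sym eq))
... | tri> _ _ h<1+r = trans (≤⇒<ᵇ-false (≤-pred h<1+r)) (sym (≤⇒<ᵇ-false (<⇒≤ h<1+r)))

xor-false⇒≡ : ∀ {a b} → a xor b ≡ false → a ≡ b
xor-false⇒≡ {true}  {true}  _ = refl
xor-false⇒≡ {false} {false} _ = refl

xor-true⇒false : ∀ {a b} → a xor b ≡ true → a ≡ true → b ≡ false
xor-true⇒false {true} {false} _ _ = refl

true⇔true⇒≡ : ∀ {a b} → (a ≡ true → b ≡ true) → (b ≡ true → a ≡ true) → a ≡ b
true⇔true⇒≡ {true}  {b}     a⇒b _   = sym (a⇒b refl)
true⇔true⇒≡ {false} {true}  _ a⇐b = a⇐b refl
true⇔true⇒≡ {false} {false} _ _   = refl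

-- Counting with Boolean predicates

⟦_⟧ : Bool → ℕ
⟦ true ⟧  = 1
⟦ false ⟧ = 0

module _ {A : Set} where

  countB-cons : ∀ (f : A → Bool) a L → countB f (a ∷ L) ≡ ⟦ f a ⟧ + countB f L
  countB-cons f a L with f a
  ... | true  = refl
  ... | false = refl

  countB-++ : ∀ (f : A → Bool) xs ys → countB f (xs ++ ys) ≡ countB f xs + countB f ys
  countB-++ f []       ys = refl
  countB-++ f (a ∷ xs) ys with f a
  ... | true  = cong suc (countB-++ f xs ys)
  ... | false = countB-++ f xs ys

  countB-cong : ∀ {f g : A → Bool} → (∀ a → f a ≡ g a) → ∀ L → countB f L ≡ countB g L
  countB-cong f≗g []      = refl
  countB-cong f≗g (a ∷ L) rewrite f≗g a | countB-cong f≗g L = refl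

  countB-false : ∀ L → countB {A} (λ _ → false) L ≡ 0
  countB-false []      = refl
  countB-false (_ ∷ L) = countB-false L

  countB-split : ∀ (f c : A → Bool) L →
    countB f L ≡ countB (λ v → f v ∧ c v) L + countB (λ v → f v ∧ not (c v)) L
  countB-split f c []      = refl
  countB-split f c (a ∷ L) with f a | c a | countB-split f c L
  ... | true  | true  | ih = cong suc ih
  ... | true  | false | ih = trans (cong suc ih) (sym (+-suc _ _))
  ... | false | true  | ih = ih
  ... | false | false | ih = ih

  countB-tabulate : ∀ {N} (f : A → Bool) (h : Fin N → A) →
    countB f (tabulate h) ≡ ∑[ i < N ] ⟦ f (h i) ⟧
  countB-tabulate {zero}  f h = refl
  countB-tabulate {suc N} f h =
    trans (countB-cons f (h fzero) (tabulate (h ∘ fsuc)))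
          (cong (⟦ f (h fzero) ⟧ +_) (countB-tabulate f (h ∘ fsuc)))

countB-map : ∀ {A B : Set} (f : B → Bool) (g : A → B) L → countB f (map g L) ≡ countB (f ∘ g) L
countB-map f g []      = refl
countB-map f g (a ∷ L) rewrite countB-map f g L = refl

countB-concatMap : ∀ {A B : Set} {N} (f : B → Bool) (g : A → List B) (h : Fin N → A) →
  countB f (concatMap g (tabulate h)) ≡ ∑[ i < N ] countB f (g (h i))
countB-concatMap {N = zero}  f g h = refl
countB-concatMap {N = suc N} f g h =
  trans (countB-++ f (g (h fzero)) _) (cong (countB f (g (h fzero)) +_) (countB-concatMap f g (h ∘ fsuc)))

countB-pairs : ∀ k (f : Fin k × Fin k → Bool) →
  countB f (pairs k) ≡ ∑[ p < k ] ∑[ q < k ] ⟦ f (p , q) ⟧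
countB-pairs k f = trans (countB-concatMap f (λ p → map (p ,_) (allFin k)) (λ p → p))
  (sum-cong-≗ (λ p → trans (countB-map f (p ,_) (allFin k)) (countB-tabulate (f ∘ (p ,_)) (λ q → q))))

countB-allVecs : ∀ m k (f : Vec (Fin m) (suc k) → Bool) →
  countB f (allVecs m (suc k)) ≡ ∑[ c < m ] countB (f ∘ (c ∷_)) (allVecs m k)
countB-allVecs m k f = trans (countB-concatMap f (λ c → map (c ∷_) (allVecs m k)) (λ c → c))
  (sum-cong-≗ (λ c → countB-map f (c ∷_) (allVecs m k)))

all⇒All : ∀ {A : Set} (f : A → Bool) L → all f L ≡ true → All (λ a → f a ≡ true) L
all⇒All f []      _  = []
all⇒All f (a ∷ L) eq with f a in fa
... | true = fa ∷ all⇒All f L eq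

All⇒all : ∀ {A : Set} (f : A → Bool) {L} → All (λ a → f a ≡ true) L → all f L ≡ true
All⇒all f []           = refl
All⇒all f (fa ∷ f[L]) rewrite fa = All⇒all f f[L]

pair∈pairs : ∀ {k} (p q : Fin k) → (p , q) ∈ pairs k
pair∈pairs {k} p q = ∈-concatMap⁺ (λ a → map (a ,_) (allFin k)) (Any.map (λ { refl → ∈-map⁺ (p ,_) (∈-allFin q) }) (∈-allFin p))

all-pairs⁻ : ∀ {k} (f : Fin k × Fin k → Bool) → all f (pairs k) ≡ true → ∀ p q → f (p , q) ≡ true
all-pairs⁻ {k} f eq p q = All.lookup (all⇒All f (pairs k) eq) (pair∈pairs p q)

all-pairs⁺ : ∀ {k} (f : Fin k × Fin k → Bool) → (∀ p q → f (p , q) ≡ true) → all f (pairs k) ≡ true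
all-pairs⁺ {k} f H = All⇒all f {pairs k} (All.tabulate (λ {pq} _ → H (proj₁ pq) (proj₂ pq)))

∑-indicator : ∀ {N} i → i < N → ∑[ p < N ] ⟦ toℕ p ≡ᵇ i ⟧ ≡ 1
∑-indicator {suc N} zero    _         = cong suc (sum-replicate-zero N)
∑-indicator {suc N} (suc i) (s≤s i<N) = ∑-indicator {N} i i<N

∑∑-indicator : ∀ {N} i j → i < N → j < N → ∑[ p < N ] ∑[ q < N ] ⟦ (toℕ p ≡ᵇ i) ∧ (toℕ q ≡ᵇ j) ⟧ ≡ 1
∑∑-indicator {N} i j i<N j<N = trans (sum-cong-≗ {N} row) (∑-indicator {N} i i<N)
  where
  row : ∀ p → ∑[ q < N ] ⟦ (toℕ p ≡ᵇ i) ∧ (toℕ q ≡ᵇ j) ⟧ ≡ ⟦ toℕ p ≡ᵇ i ⟧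
  row p with toℕ p ≡ᵇ i
  ... | true  = ∑-indicator {N} j j<N
  ... | false = sum-replicate-zero N

∑∑-plus-point : ∀ {N} (F G : Fin N → Fin N → ℕ) i j → i < N → j < N →
  (∀ p q → F p q ≡ G p q + ⟦ (toℕ p ≡ᵇ i) ∧ (toℕ q ≡ᵇ j) ⟧) →
  ∑[ p < N ] ∑[ q < N ] F p q ≡ suc (∑[ p < N ] ∑[ q < N ] G p q)
∑∑-plus-point {N} F G i j i<N j<N F≡G+δ = begin
  ∑[ p < N ] ∑[ q < N ] F p q
    ≡⟨ sum-cong-≗ {N} (λ p → trans (sum-cong-≗ {N} (F≡G+δ p)) (∑-distrib-+ (G p) (δ p))) ⟩
  ∑[ p < N ] (∑[ q < N ] G p q + ∑[ q < N ] δ p q)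
    ≡⟨ ∑-distrib-+ (λ p → ∑[ q < N ] G p q) (λ p → ∑[ q < N ] δ p q) ⟩
  ∑[ p < N ] ∑[ q < N ] G p q + ∑[ p < N ] ∑[ q < N ] δ p q
    ≡⟨ cong (∑[ p < N ] ∑[ q < N ] G p q +_) (∑∑-indicator i j i<N j<N) ⟩
  ∑[ p < N ] ∑[ q < N ] G p q + 1
    ≡⟨ +-comm _ 1 ⟩
  suc (∑[ p < N ] ∑[ q < N ] G p q) ∎
  where
  open ≡-Reasoning
  δ : Fin N → Fin N → ℕ
  δ p q = ⟦ (toℕ p ≡ᵇ i) ∧ (toℕ q ≡ᵇ j) ⟧

∑∑-permute : ∀ {N} (F : Fin N → Fin N → ℕ) (π : Perm.Permutation N N) →
  ∑[ p < N ] ∑[ q < N ] F p q ≡ ∑[ p < N ] ∑[ q < N ] F (π Perm.⟨$⟩ʳ p) (π Perm.⟨$⟩ʳ q)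
∑∑-permute {N} F π = trans (sum-permute (λ p → ∑[ q < N ] F p q) π)
  (sum-cong-≗ {N} (λ p → sum-permute (F (π Perm.⟨$⟩ʳ p)) π))

-- swapAt i v exchanges the entries i and i+1 of v (and is the identity when
-- i+1 is out of range).
swapAt : ∀ {A : Set} {k} → ℕ → Vec A k → Vec A k
swapAt zero    []          = []
swapAt zero    (a ∷ [])    = a ∷ []
swapAt zero    (a ∷ b ∷ v) = b ∷ a ∷ v
swapAt (suc i) []          = []
swapAt (suc i) (a ∷ v)     = a ∷ swapAt i v

-- swapAt i is a bijection of the colour vectors, so counting any property of
-- the swapped vector counts the property itself.  The step i = 0 is Fubini's
-- exchange of the sums over the first two colours.
countB-swapAt : ∀ m i k (f : Vec (Fin m) k → Bool) →
  countB (f ∘ swapAt i) (allVecs m k) ≡ countB f (allVecs m k)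
countB-swapAt m zero zero f = refl
countB-swapAt m zero (suc zero) f = countB-cong (λ { (a ∷ []) → refl }) (allVecs m 1)
countB-swapAt m zero (suc (suc k)) f = begin
  countB (f ∘ swapAt 0) (allVecs m (suc (suc k)))
    ≡⟨ countB-allVecs m (suc k) (f ∘ swapAt 0) ⟩
  ∑[ c < m ] countB (f ∘ swapAt 0 ∘ (c ∷_)) (allVecs m (suc k))
    ≡⟨ sum-cong-≗ (λ c → countB-allVecs m k (f ∘ swapAt 0 ∘ (c ∷_))) ⟩
  ∑[ c < m ] ∑[ c′ < m ] countB (λ v → f (c′ ∷ c ∷ v)) (allVecs m k)
    ≡⟨ ∑-comm (λ c c′ → countB (λ v → f (c′ ∷ c ∷ v)) (allVecs m k)) ⟩
  ∑[ c′ < m ] ∑[ c < m ] countB (λ v → f (c′ ∷ c ∷ v)) (allVecs m k)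
    ≡⟨ sum-cong-≗ (λ c′ → countB-allVecs m k (f ∘ (c′ ∷_))) ⟨
  ∑[ c′ < m ] countB (f ∘ (c′ ∷_)) (allVecs m (suc k))
    ≡⟨ countB-allVecs m (suc k) f ⟨
  countB f (allVecs m (suc (suc k))) ∎
  where open ≡-Reasoning
countB-swapAt m (suc i) zero f = refl
countB-swapAt m (suc i) (suc k) f =
  trans (countB-allVecs m k (f ∘ swapAt (suc i)))
  (trans (sum-cong-≗ (λ c → countB-swapAt m i k (f ∘ (c ∷_))))
         (sym (countB-allVecs m k f)))

-- The same holds when only the vectors satisfying a swap-invariant test c are
-- swapped: both classes are separately closed under the swap.
countB-swapIf : ∀ m k i (c : Vec (Fin m) k → Bool) → (∀ v → c (swapAt i v) ≡ c v) →
  (g : Vec (Fin m) k → Bool) →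
  countB (λ v → g (if c v then swapAt i v else v)) (allVecs m k) ≡ countB g (allVecs m k)
countB-swapIf m k i c c-inv g = begin
  countB g′ vs                                                           ≡⟨ countB-split g′ c vs ⟩
  countB (λ v → g′ v ∧ c v) vs + countB (λ v → g′ v ∧ not (c v)) vs     ≡⟨ cong₂ _+_ swapped kept ⟩
  countB (λ v → g v ∧ c v) vs + countB (λ v → g v ∧ not (c v)) vs       ≡⟨ countB-split g c vs ⟨
  countB g vs                                                            ∎
  where
  open ≡-Reasoning
  vs : List (Vec (Fin m) k)
  vs = allVecs m k

  g′ : Vec (Fin m) k → Bool
  g′ v = g (if c v then swapAt i v else v)

  on-swapped : ∀ v → (g′ v ∧ c v) ≡ (g (swapAt i v) ∧ c (swapAt i v))
  on-swapped v rewrite c-inv v with c v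
  ... | true  = refl
  ... | false = trans (∧-zeroʳ _) (sym (∧-zeroʳ _))

  on-kept : ∀ v → (g′ v ∧ not (c v)) ≡ (g v ∧ not (c v))
  on-kept v with c v
  ... | true  = trans (∧-zeroʳ _) (sym (∧-zeroʳ _))
  ... | false = refl

  swapped : countB (λ v → g′ v ∧ c v) vs ≡ countB (λ v → g v ∧ c v) vs
  swapped = trans (countB-cong on-swapped vs) (countB-swapAt m i k (λ w → g w ∧ c w))
  kept : countB (λ v → g′ v ∧ not (c v)) vs ≡ countB (λ v → g v ∧ not (c v)) vs
  kept = countB-cong on-kept vs

-- Geometry of path segments

endFrom-++ : ∀ p (L M : Path) → endFrom p (L ++ M) ≡ endFrom (endFrom p L) M
endFrom-++ p []      M = refl
endFrom-++ p (s ∷ L) M = endFrom-++ (move s p) L M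

stepsFrom-++ : ∀ p (L M : Path) → stepsFrom p (L ++ M) ≡ stepsFrom p L ++ stepsFrom (endFrom p L) M
stepsFrom-++ p []      M = refl
stepsFrom-++ p (s ∷ L) M = cong ((s , p) ∷_) (stepsFrom-++ (move s p) L M)

_≤₂_ : ℕ × ℕ → ℕ × ℕ → Set
(a , b) ≤₂ (c , d′) = a ≤ c × b ≤ d′

≤₂-refl : ∀ {p} → p ≤₂ p
≤₂-refl = ≤-refl , ≤-refl

≤₂-trans : ∀ {p q r} → p ≤₂ q → q ≤₂ r → p ≤₂ r
≤₂-trans (a≤c , b≤d) (c≤e , d≤f) = ≤-trans a≤c c≤e , ≤-trans b≤d d≤f

move-≤₂ : ∀ s p → p ≤₂ move s p
move-≤₂ n (a , b) = ≤-refl , n≤1+n b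
move-≤₂ e (a , b) = n≤1+n a , ≤-refl
move-≤₂ d (a , b) = n≤1+n a , n≤1+n b

endFrom-≥ : ∀ p L → p ≤₂ endFrom p L
endFrom-≥ p []      = ≤₂-refl
endFrom-≥ p (s ∷ L) = ≤₂-trans {p} (move-≤₂ s p) (endFrom-≥ (move s p) L)

InBox : ℕ × ℕ → ℕ × ℕ → Step × ℕ × ℕ → Set
InBox p q (s , a , h) = p ≤₂ (a , h) × move s (a , h) ≤₂ q

steps-inBox : ∀ p L → All (InBox p (endFrom p L)) (stepsFrom p L)
steps-inBox p []      = []
steps-inBox p (s ∷ L) = (≤₂-refl , endFrom-≥ (move s p) L) ∷ All.map (λ {t} → later {t}) (steps-inBox (move s p) L)
  where
  later : ∀ {t} → InBox (move s p) (endFrom (move s p) L) t → InBox p (endFrom (move s p) L) t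
  later {_ , a , h} (after , before) = ≤₂-trans {p} (move-≤₂ s p) after , before

segment-inBox : ∀ {p q} L → endFrom p L ≡ q → All (InBox p q) (stepsFrom p L)
segment-inBox {p} L refl = steps-inBox p L

crossAbove : ℕ → ℕ → Step × ℕ × ℕ → Bool
crossAbove a b (s , x , y) = isED s ∧ (x ≡ᵇ a) ∧ (b <ᵇ y)

diagAt : ℕ → ℕ → Step × ℕ × ℕ → Bool
diagAt a b (s , x , y) = isStep d s ∧ (x ≡ᵇ a) ∧ (y ≡ᵇ b)

any-++ : ∀ {A : Set} (f : A → Bool) xs ys → any f (xs ++ ys) ≡ (any f xs ∨ any f ys)
any-++ f []       ys = refl
any-++ f (a ∷ xs) ys rewrite any-++ f xs ys = sym (∨-assoc (f a) (any f xs) (any f ys))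

any-false : ∀ {A : Set} {Q : A → Set} (f : A → Bool) → (∀ {t} → Q t → f t ≡ false) →
  ∀ {L} → All Q L → any f L ≡ false
any-false f H []         = refl
any-false f H (qt ∷ qL) rewrite H qt = any-false f H qL

any-cong : ∀ {A : Set} {Q : A → Set} (f g : A → Bool) → (∀ {t} → Q t → f t ≡ g t) →
  ∀ {L} → All Q L → any f L ≡ any g L
any-cong f g H []         = refl
any-cong f g H (qt ∷ qL) = cong₂ _∨_ (H qt) (any-cong f g H qL)

any-split : ∀ {A : Set} (f : A → Bool) L₁ t₁ t₂ L₂ t₃ t₄ L₃ → f t₁ ≡ false → f t₂ ≡ false →
  any f (L₁ ++ t₁ ∷ t₂ ∷ L₂ ++ t₃ ∷ t₄ ∷ L₃) ≡ (any f L₁ ∨ (any f L₂ ∨ any f L₃)) ∨ (f t₃ ∨ f t₄)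
any-split f L₁ t₁ t₂ L₂ t₃ t₄ L₃ ft₁ ft₂
  rewrite any-++ f L₁ (t₁ ∷ t₂ ∷ L₂ ++ t₃ ∷ t₄ ∷ L₃) | ft₁ | ft₂ | any-++ f L₂ (t₃ ∷ t₄ ∷ L₃)
  = shuffle (any f L₁) (any f L₂) (f t₃) (f t₄) (any f L₃)
  where
  shuffle : ∀ a b c d′ e′ → (a ∨ (b ∨ (c ∨ (d′ ∨ e′)))) ≡ ((a ∨ (b ∨ e′)) ∨ (c ∨ d′))
  shuffle true  b c d′ e′ = refl
  shuffle false true c d′ e′ = refl
  shuffle false false c d′ e′ = trans (sym (∨-assoc c d′ e′)) (∨-comm (c ∨ d′) e′)

module Segment {p q : ℕ × ℕ} {S : List (Step × ℕ × ℕ)} (inBox : All (InBox p q) S) where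

  outside≢ : ∀ {lo hi a x} → lo ≤ x → x < hi → a < lo ⊎ hi ≤ a → x ≢ a
  outside≢ lo≤x x<hi (inj₁ a<lo) refl = <⇒≱ a<lo lo≤x
  outside≢ lo≤x x<hi (inj₂ hi≤a) refl = <⇒≱ x<hi hi≤a

  noCross-column : ∀ {a b} → a < proj₁ p ⊎ proj₁ q ≤ a → any (crossAbove a b) S ≡ false
  noCross-column {a} {b} out = any-false (crossAbove a b) (λ {t} → step {t}) inBox
    where
    step : ∀ {t} → InBox p q t → crossAbove a b t ≡ false
    step {n , x , h} _ = refl
    step {e , x , h} ((px≤x , _) , (x<qx , _)) rewrite ≢⇒≡ᵇ-false (outside≢ px≤x x<qx out) = refl
    step {d , x , h} ((px≤x , _) , (x<qx , _)) rewrite ≢⇒≡ᵇ-false (outside≢ px≤x x<qx out) = refl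

  noDiag-column : ∀ {a b} → a < proj₁ p ⊎ proj₁ q ≤ a → any (diagAt a b) S ≡ false
  noDiag-column {a} {b} out = any-false (diagAt a b) (λ {t} → step {t}) inBox
    where
    step : ∀ {t} → InBox p q t → diagAt a b t ≡ false
    step {n , x , h} _ = refl
    step {e , x , h} _ = refl
    step {d , x , h} ((px≤x , _) , (x<qx , _)) rewrite ≢⇒≡ᵇ-false (outside≢ px≤x x<qx out) = refl

  noDiag-row : ∀ {a b} → b < proj₂ p ⊎ proj₂ q ≤ b → any (diagAt a b) S ≡ false
  noDiag-row {a} {b} out = any-false (diagAt a b) (λ {t} → step {t}) inBox
    where
    step : ∀ {t} → InBox p q t → diagAt a b t ≡ false
    step {n , x , h} _ = refl
    step {e , x , h} _ = refl
    step {d , x , h} ((_ , py≤h) , (_ , h<qy)) rewrite ≢⇒≡ᵇ-false (outside≢ py≤h h<qy out) =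
      ∧-zeroʳ (x ≡ᵇ a)

  -- If no non-north step starts at height r+1, the rows r and r+1 see the same
  -- steps above them.
  crossAbove-rows : ∀ {a r} → proj₂ q ≤ r ⊎ suc r < proj₂ p →
    any (crossAbove a r) S ≡ any (crossAbove a (suc r)) S
  crossAbove-rows {a} {r} out = any-cong (crossAbove a r) (crossAbove a (suc r)) (λ {t} → step {t}) inBox
    where
    height≢ : ∀ {h} → proj₂ p ≤ h → h ≤ proj₂ q → h ≢ suc r
    height≢ py≤h h≤qy refl = [ (λ qy≤r → 1+n≰n (≤-trans h≤qy qy≤r)) , (λ 1+r<py → <⇒≱ 1+r<py py≤h) ]′ out
    step : ∀ {t} → InBox p q t → crossAbove a r t ≡ crossAbove a (suc r) t
    step {n , x , h} _ = refl
    step {e , x , h} ((_ , py≤h) , (_ , h≤qy)) rewrite <ᵇ-suc-left (height≢ py≤h h≤qy) = refl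
    step {d , x , h} ((_ , py≤h) , (_ , h<qy)) rewrite <ᵇ-suc-left (height≢ py≤h (<⇒≤ h<qy)) = refl

-- Colourings and their ascents

Col : ∀ {m k} → Path → Vec (Fin m) k → Set
Col {k = k} R κ =
  ∀ (p q : Fin k) → strictEdge R (toℕ p) (toℕ q) ≡ true → lt (lookup κ p) (lookup κ q) ≡ true

isColoring⇒Col : ∀ {m k} R (κ : Vec (Fin m) k) → isColoring R κ ≡ true → Col R κ
isColoring⇒Col R κ col p q st =
  subst (λ b → (if b then lt (lookup κ p) (lookup κ q) else true) ≡ true) st (all-pairs⁻ _ col p q)

Col⇒isColoring : ∀ {m k} R (κ : Vec (Fin m) k) → Col R κ → isColoring R κ ≡ true
Col⇒isColoring R κ H = all-pairs⁺ _ cell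
  where
  cell : ∀ p q → (if strictEdge R (toℕ p) (toℕ q) then lt (lookup κ p) (lookup κ q) else true) ≡ true
  cell p q with strictEdge R (toℕ p) (toℕ q) in st
  ... | true  = H p q st
  ... | false = refl

asc-sum : ∀ {m k} R (κ : Vec (Fin m) k) →
  asc R κ ≡ ∑[ p < k ] ∑[ q < k ] ⟦ nonStrictEdge R (toℕ p) (toℕ q) ∧ lt (lookup κ p) (lookup κ q) ⟧
asc-sum {k = k} R κ = countB-pairs k _

-- swapℕ i is the transposition of i and i+1 on ℕ; it describes the positions
-- moved by swapAt i.
swapℕ : ℕ → ℕ → ℕ
swapℕ zero    zero          = 1
swapℕ zero    (suc zero)    = 0
swapℕ zero    (suc (suc j)) = suc (suc j)
swapℕ (suc i) zero          = 0
swapℕ (suc i) (suc j)       = suc (swapℕ i j)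

swapℕ-left : ∀ i → swapℕ i i ≡ suc i
swapℕ-left zero    = refl
swapℕ-left (suc i) = cong suc (swapℕ-left i)

swapℕ-right : ∀ i → swapℕ i (suc i) ≡ i
swapℕ-right zero    = refl
swapℕ-right (suc i) = cong suc (swapℕ-right i)

swapℕ-other : ∀ {i j} → j ≢ i → j ≢ suc i → swapℕ i j ≡ j
swapℕ-other {zero}  {zero}        j≢i _     = ⊥-elim (j≢i refl)
swapℕ-other {zero}  {suc zero}    _   j≢1+i = ⊥-elim (j≢1+i refl)
swapℕ-other {zero}  {suc (suc j)} _   _     = refl
swapℕ-other {suc i} {zero}        _   _     = refl
swapℕ-other {suc i} {suc j}       j≢i j≢1+i = cong suc (swapℕ-other (j≢i ∘ cong suc) (j≢1+i ∘ cong suc))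

swapℕ-involutive : ∀ i j → swapℕ i (swapℕ i j) ≡ j
swapℕ-involutive zero    zero          = refl
swapℕ-involutive zero    (suc zero)    = refl
swapℕ-involutive zero    (suc (suc j)) = refl
swapℕ-involutive (suc i) zero          = refl
swapℕ-involutive (suc i) (suc j)       = cong suc (swapℕ-involutive i j)

lookup-swapAt : ∀ {A : Set} {k} i (κ : Vec A k) (p q : Fin k) → toℕ q ≡ swapℕ i (toℕ p) → suc i < k →
  lookup (swapAt i κ) p ≡ lookup κ q
lookup-swapAt zero    (a ∷ b ∷ v) fzero             (fsuc fzero)     _  _ = refl
lookup-swapAt zero    (a ∷ b ∷ v) (fsuc fzero)      fzero            _  _ = refl
lookup-swapAt zero    (a ∷ b ∷ v) (fsuc (fsuc p))   (fsuc (fsuc q)) eq _ =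
  cong (lookup v) (toℕ-injective (suc-injective (suc-injective (sym eq))))
lookup-swapAt zero    (a ∷ b ∷ v) (fsuc (fsuc p))   (fsuc fzero)    eq _ = ⊥-elim (1+n≢0 (suc-injective (sym eq)))
lookup-swapAt zero    (a ∷ [])    p                 q                _  (s≤s ())
lookup-swapAt (suc i) (a ∷ v)     fzero             fzero            _  _ = refl
lookup-swapAt (suc i) (a ∷ v)     (fsuc p)          (fsuc q)        eq (s≤s i<k) =
  lookup-swapAt i v p q (suc-injective eq) i<k
lookup-swapAt zero    (a ∷ b ∷ v) fzero             fzero            () _
lookup-swapAt zero    (a ∷ b ∷ v) fzero             (fsuc (fsuc q))  () _
lookup-swapAt zero    (a ∷ b ∷ v) (fsuc fzero)      (fsuc q)         () _
lookup-swapAt zero    (a ∷ b ∷ v) (fsuc (fsuc p))   fzero            () _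
lookup-swapAt (suc i) (a ∷ v)     fzero             (fsuc q)         () _
lookup-swapAt (suc i) (a ∷ v)     (fsuc p)          fzero            () _

toℕ≡⇒≡fromℕ< : ∀ {k i} {p : Fin k} (i<k : i < k) → toℕ p ≡ i → p ≡ fromℕ< i<k
toℕ≡⇒≡fromℕ< i<k p≐i = toℕ-injective (trans p≐i (sym (toℕ-fromℕ< i<k)))

content-swapAt : ∀ {m k} i (κ : Vec (Fin m) k) → content (swapAt i κ) ≡ content κ
content-swapAt zero    []          = refl
content-swapAt zero    (a ∷ [])    = refl
content-swapAt zero    (a ∷ b ∷ v) with a Fin.≟ b
... | yes refl = refl
... | no a≢b   = updateAt-commutes b a (a≢b ∘ sym) (content v)
content-swapAt (suc i) []          = refl
content-swapAt (suc i) (a ∷ v)     = cong (λ w → updateAt w a suc) (content-swapAt i v)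

-- The exchange of  d e  into  e d  after a double north step

module Exchange (U V W : Path) (u X C k : ℕ)
  (U-end : endpoint U ≡ (u , X))
  (V-end : endFrom (u , suc (suc X)) V ≡ (X , C))
  (W-end : endFrom (suc (suc X) , suc C) W ≡ (k , k))
  (1+X<C : suc X < C) where

  P Q : Path
  P = U ++ n ∷ n ∷ V ++ d ∷ e ∷ W
  Q = U ++ n ∷ n ∷ V ++ e ∷ d ∷ W

  stepsU stepsV stepsW : List (Step × ℕ × ℕ)
  stepsU = stepsFrom (0 , 0) U
  stepsV = stepsFrom (u , suc (suc X)) V
  stepsW = stepsFrom (suc (suc X) , suc C) W

  steps-shape : ∀ s₁ s₂ → steps (U ++ n ∷ n ∷ V ++ s₁ ∷ s₂ ∷ W) ≡
    stepsU ++ (n , u , X) ∷ (n , u , suc X) ∷ stepsV ++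
      (s₁ , X , C) ∷ (s₂ , move s₁ (X , C)) ∷ stepsFrom (move s₂ (move s₁ (X , C))) W
  steps-shape s₁ s₂ = begin
    steps (U ++ n ∷ n ∷ V ++ s₁ ∷ s₂ ∷ W)
      ≡⟨ stepsFrom-++ (0 , 0) U _ ⟩
    stepsU ++ stepsFrom (endpoint U) (n ∷ n ∷ V ++ s₁ ∷ s₂ ∷ W)
      ≡⟨ cong (λ p → stepsU ++ stepsFrom p (n ∷ n ∷ V ++ s₁ ∷ s₂ ∷ W)) U-end ⟩
    stepsU ++ (n , u , X) ∷ (n , u , suc X) ∷ stepsFrom (u , suc (suc X)) (V ++ s₁ ∷ s₂ ∷ W)
      ≡⟨ cong (λ L → stepsU ++ (n , u , X) ∷ (n , u , suc X) ∷ L) (stepsFrom-++ _ V _) ⟩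
    stepsU ++ (n , u , X) ∷ (n , u , suc X) ∷ stepsV ++ stepsFrom (endFrom (u , suc (suc X)) V) (s₁ ∷ s₂ ∷ W)
      ≡⟨ cong (λ p → stepsU ++ (n , u , X) ∷ (n , u , suc X) ∷ stepsV ++ stepsFrom p (s₁ ∷ s₂ ∷ W)) V-end ⟩
    stepsU ++ (n , u , X) ∷ (n , u , suc X) ∷ stepsV ++
      (s₁ , X , C) ∷ (s₂ , move s₁ (X , C)) ∷ stepsFrom (move s₂ (move s₁ (X , C))) W ∎
    where open ≡-Reasoning

  off : (Step × ℕ × ℕ → Bool) → Bool
  off f = any f stepsU ∨ (any f stepsV ∨ any f stepsW)

  nonStrict-P : ∀ a b → nonStrictEdge P a b ≡
    (a <ᵇ b) ∧ (off (crossAbove a b) ∨ (((X ≡ᵇ a) ∧ (b <ᵇ C)) ∨ ((suc X ≡ᵇ a) ∧ (b <ᵇ suc C))))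
  nonStrict-P a b = cong ((a <ᵇ b) ∧_)
    (trans (cong (any (crossAbove a b)) (steps-shape d e)) (any-split _ stepsU _ _ stepsV _ _ stepsW refl refl))

  nonStrict-Q : ∀ a b → nonStrictEdge Q a b ≡
    (a <ᵇ b) ∧ (off (crossAbove a b) ∨ (((X ≡ᵇ a) ∧ (b <ᵇ C)) ∨ ((suc X ≡ᵇ a) ∧ (b <ᵇ C))))
  nonStrict-Q a b = cong ((a <ᵇ b) ∧_)
    (trans (cong (any (crossAbove a b)) (steps-shape e d)) (any-split _ stepsU _ _ stepsV _ _ stepsW refl refl))

  strict-P : ∀ a b → strictEdge P a b ≡
    (a <ᵇ b) ∧ (off (diagAt a b) ∨ (((X ≡ᵇ a) ∧ (C ≡ᵇ b)) ∨ false))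
  strict-P a b = cong ((a <ᵇ b) ∧_)
    (trans (cong (any (diagAt a b)) (steps-shape d e)) (any-split _ stepsU _ _ stepsV _ _ stepsW refl refl))

  strict-Q : ∀ a b → strictEdge Q a b ≡
    (a <ᵇ b) ∧ (off (diagAt a b) ∨ (false ∨ ((suc X ≡ᵇ a) ∧ (C ≡ᵇ b))))
  strict-Q a b = cong ((a <ᵇ b) ∧_)
    (trans (cong (any (diagAt a b)) (steps-shape e d)) (any-split _ stepsU _ _ stepsV _ _ stepsW refl refl))

  inBox-U : All (InBox (0 , 0) (u , X)) stepsU
  inBox-U = segment-inBox U U-end

  inBox-V : All (InBox (u , suc (suc X)) (X , C)) stepsV
  inBox-V = segment-inBox V V-end

  inBox-W : All (InBox (suc (suc X) , suc C) (k , k)) stepsW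
  inBox-W = segment-inBox W W-end

  u≤X : u ≤ X
  u≤X = proj₁ (subst ((u , suc (suc X)) ≤₂_) V-end (endFrom-≥ _ V))

  C<k : C < k
  C<k = proj₂ (subst ((suc (suc X) , suc C) ≤₂_) W-end (endFrom-≥ _ W))

  offCross-column : ∀ {a b} → X ≤ a → a ≤ suc X → off (crossAbove a b) ≡ false
  offCross-column {a} {b} X≤a a≤1+X =
    cong₂ _∨_ (Segment.noCross-column inBox-U {a} {b} (inj₂ (≤-trans u≤X X≤a)))
     (cong₂ _∨_ (Segment.noCross-column inBox-V {a} {b} (inj₂ X≤a))
                (Segment.noCross-column inBox-W {a} {b} (inj₁ (s≤s a≤1+X))))

  offDiag-column : ∀ {a b} → X ≤ a → a ≤ suc X → off (diagAt a b) ≡ false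
  offDiag-column {a} {b} X≤a a≤1+X =
    cong₂ _∨_ (Segment.noDiag-column inBox-U {a} {b} (inj₂ (≤-trans u≤X X≤a)))
     (cong₂ _∨_ (Segment.noDiag-column inBox-V {a} {b} (inj₂ X≤a))
                (Segment.noDiag-column inBox-W {a} {b} (inj₁ (s≤s a≤1+X))))

  offDiag-row : ∀ {a b} → X ≤ b → b ≤ suc X → off (diagAt a b) ≡ false
  offDiag-row {a} {b} X≤b b≤1+X =
    cong₂ _∨_ (Segment.noDiag-row inBox-U {a} {b} (inj₂ X≤b))
     (cong₂ _∨_ (Segment.noDiag-row inBox-V {a} {b} (inj₁ (s≤s b≤1+X)))
                (Segment.noDiag-row inBox-W {a} {b} (inj₁ (≤-<-trans b≤1+X (m<n⇒m<1+n 1+X<C)))))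

  offCross-rows : ∀ a → off (crossAbove a X) ≡ off (crossAbove a (suc X))
  offCross-rows a =
    cong₂ _∨_ (Segment.crossAbove-rows inBox-U {a} (inj₁ ≤-refl))
     (cong₂ _∨_ (Segment.crossAbove-rows inBox-V {a} (inj₂ ≤-refl))
                (Segment.crossAbove-rows inBox-W {a} (inj₂ (m<n⇒m<1+n 1+X<C))))

  Away : ℕ → Set
  Away a = a ≢ X × a ≢ suc X

  X≢1+X : X ≢ suc X
  X≢1+X = ≢-sym 1+n≢n

  nonStrict-same : ∀ a b → a ≢ suc X → nonStrictEdge P a b ≡ nonStrictEdge Q a b
  nonStrict-same a b a≢1+X
    rewrite nonStrict-P a b | nonStrict-Q a b | ≢⇒≡ᵇ-false (≢-sym a≢1+X) = refl

  nonStrict-X : ∀ b → nonStrictEdge P X b ≡ (X <ᵇ b) ∧ (b <ᵇ C)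
  nonStrict-X b
    rewrite nonStrict-P X b | offCross-column {X} {b} ≤-refl (n≤1+n X) | ≢⇒≡ᵇ-false (1+n≢n {X}) | ≡ᵇ-refl X
    = cong ((X <ᵇ b) ∧_) (∨-identityʳ (b <ᵇ C))

  nonStrict-P-1+X : ∀ b → nonStrictEdge P (suc X) b ≡ (suc X <ᵇ b) ∧ (b <ᵇ suc C)
  nonStrict-P-1+X b
    rewrite nonStrict-P (suc X) b | offCross-column {suc X} {b} (n≤1+n X) ≤-refl
          | ≢⇒≡ᵇ-false X≢1+X | ≡ᵇ-refl (suc X) = refl

  nonStrict-Q-1+X : ∀ b → nonStrictEdge Q (suc X) b ≡ (suc X <ᵇ b) ∧ (b <ᵇ C)
  nonStrict-Q-1+X b
    rewrite nonStrict-Q (suc X) b | offCross-column {suc X} {b} (n≤1+n X) ≤-refl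
          | ≢⇒≡ᵇ-false X≢1+X | ≡ᵇ-refl (suc X) = refl

  nonStrict-rows : ∀ a → Away a → nonStrictEdge P a X ≡ nonStrictEdge P a (suc X)
  nonStrict-rows a (a≢X , a≢1+X)
    rewrite nonStrict-P a X | nonStrict-P a (suc X) | ≢⇒≡ᵇ-false (≢-sym a≢X)
          | ≢⇒≡ᵇ-false (≢-sym a≢1+X) | offCross-rows a | <ᵇ-suc-right a≢X = refl

  strict-same : ∀ a b → Away a → strictEdge P a b ≡ strictEdge Q a b
  strict-same a b (a≢X , a≢1+X)
    rewrite strict-P a b | strict-Q a b | ≢⇒≡ᵇ-false (≢-sym a≢X) | ≢⇒≡ᵇ-false (≢-sym a≢1+X) = refl

  strict-P-X : ∀ b → strictEdge P X b ≡ (X <ᵇ b) ∧ (C ≡ᵇ b)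
  strict-P-X b
    rewrite strict-P X b | offDiag-column {X} {b} ≤-refl (n≤1+n X) | ≡ᵇ-refl X
    = cong ((X <ᵇ b) ∧_) (∨-identityʳ (C ≡ᵇ b))

  strict-P-1+X : ∀ b → strictEdge P (suc X) b ≡ false
  strict-P-1+X b
    rewrite strict-P (suc X) b | offDiag-column {suc X} {b} (n≤1+n X) ≤-refl | ≢⇒≡ᵇ-false X≢1+X
    = ∧-zeroʳ _

  strict-P-rows : ∀ a b → a ≢ X → X ≤ b → b ≤ suc X → strictEdge P a b ≡ false
  strict-P-rows a b a≢X X≤b b≤1+X
    rewrite strict-P a b | offDiag-row {a} {b} X≤b b≤1+X | ≢⇒≡ᵇ-false (≢-sym a≢X) = ∧-zeroʳ _

  strict-Q-X : ∀ b → strictEdge Q X b ≡ false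
  strict-Q-X b
    rewrite strict-Q X b | offDiag-column {X} {b} ≤-refl (n≤1+n X) | ≢⇒≡ᵇ-false (1+n≢n {X}) = ∧-zeroʳ _

  strict-Q-1+X : ∀ b → strictEdge Q (suc X) b ≡ (suc X <ᵇ b) ∧ (C ≡ᵇ b)
  strict-Q-1+X b
    rewrite strict-Q (suc X) b | offDiag-column {suc X} {b} (n≤1+n X) ≤-refl | ≡ᵇ-refl (suc X) = refl

  strict-Q-rows : ∀ a b → a ≢ suc X → X ≤ b → b ≤ suc X → strictEdge Q a b ≡ false
  strict-Q-rows a b a≢1+X X≤b b≤1+X
    rewrite strict-Q a b | offDiag-row {a} {b} X≤b b≤1+X | ≢⇒≡ᵇ-false (≢-sym a≢1+X) = ∧-zeroʳ _

  strict-P-XC : strictEdge P X C ≡ true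
  strict-P-XC rewrite strict-P-X C | <⇒<ᵇ-true (<-trans (n<1+n X) 1+X<C) | ≡ᵇ-refl C = refl

  strict-Q-1+XC : strictEdge Q (suc X) C ≡ true
  strict-Q-1+XC rewrite strict-Q-1+X C | <⇒<ᵇ-true 1+X<C | ≡ᵇ-refl C = refl

  strict-P-cases : ∀ {a b} → strictEdge P a b ≡ true →
    (a ≡ X × b ≡ C) ⊎ (Away a × Away b × strictEdge Q a b ≡ true)
  strict-P-cases {a} {b} st with a ≟ X | a ≟ suc X
  ... | yes refl | _ = inj₁ (refl , sym (≡ᵇ-true⇒≡ (∧-true⇒right (trans (sym (strict-P-X b)) st))))
  ... | no _ | yes refl = ⊥-elim (true-and-false st (strict-P-1+X b))
  ... | no a≢X | no a≢1+X with b ≟ X | b ≟ suc X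
  ...   | yes refl | _ = ⊥-elim (true-and-false st (strict-P-rows a X a≢X ≤-refl (n≤1+n X)))
  ...   | no _ | yes refl = ⊥-elim (true-and-false st (strict-P-rows a (suc X) a≢X (n≤1+n X) ≤-refl))
  ...   | no b≢X | no b≢1+X =
    inj₂ ((a≢X , a≢1+X) , (b≢X , b≢1+X) , trans (sym (strict-same a b (a≢X , a≢1+X))) st)

  strict-Q-cases : ∀ {a b} → strictEdge Q a b ≡ true →
    (a ≡ suc X × b ≡ C) ⊎ (Away a × Away b × strictEdge P a b ≡ true)
  strict-Q-cases {a} {b} st with a ≟ X | a ≟ suc X
  ... | yes refl | _ = ⊥-elim (true-and-false st (strict-Q-X b))
  ... | no _ | yes refl = inj₁ (refl , sym (≡ᵇ-true⇒≡ (∧-true⇒right (trans (sym (strict-Q-1+X b)) st))))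
  ... | no a≢X | no a≢1+X with b ≟ X | b ≟ suc X
  ...   | yes refl | _ = ⊥-elim (true-and-false st (strict-Q-rows a X a≢1+X ≤-refl (n≤1+n X)))
  ...   | no _ | yes refl = ⊥-elim (true-and-false st (strict-Q-rows a (suc X) a≢1+X (n≤1+n X) ≤-refl))
  ...   | no b≢X | no b≢1+X =
    inj₂ ((a≢X , a≢1+X) , (b≢X , b≢1+X) , trans (strict-same a b (a≢X , a≢1+X)) st)

  nonStrict-Q-X : ∀ b → nonStrictEdge Q X b ≡ (X <ᵇ b) ∧ (b <ᵇ C)
  nonStrict-Q-X b = trans (sym (nonStrict-same X b X≢1+X)) (nonStrict-X b)

  relabel-away : ∀ a b → Away a → nonStrictEdge P a b ≡ nonStrictEdge Q a (swapℕ X b)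
  relabel-away a b away@(_ , a≢1+X) with b ≟ X | b ≟ suc X
  ... | yes refl | _ rewrite swapℕ-left X =
    trans (nonStrict-rows a away) (nonStrict-same a (suc X) a≢1+X)
  ... | no _ | yes refl rewrite swapℕ-right X =
    trans (sym (nonStrict-rows a away)) (nonStrict-same a X a≢1+X)
  ... | no b≢X | no b≢1+X rewrite swapℕ-other b≢X b≢1+X = nonStrict-same a b a≢1+X

  relabel-X : ∀ b → b ≢ suc X → nonStrictEdge P X b ≡ nonStrictEdge Q (suc X) (swapℕ X b)
  relabel-X b b≢1+X with b ≟ X
  ... | yes refl rewrite swapℕ-left X | nonStrict-X X | nonStrict-Q-1+X (suc X)
                       | ≤⇒<ᵇ-false {X} ≤-refl = refl
  ... | no b≢X rewrite swapℕ-other b≢X b≢1+X | nonStrict-X b | nonStrict-Q-1+X b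
                     | <ᵇ-suc-left b≢1+X = refl

  relabel-1+X : ∀ b → b ≢ X → b ≢ C → nonStrictEdge P (suc X) b ≡ nonStrictEdge Q X (swapℕ X b)
  relabel-1+X b b≢X b≢C with b ≟ suc X
  ... | yes refl rewrite swapℕ-right X | nonStrict-P-1+X (suc X) | nonStrict-Q-X X
                       | ≤⇒<ᵇ-false {X} ≤-refl = refl
  ... | no b≢1+X rewrite swapℕ-other b≢X b≢1+X | nonStrict-P-1+X b | nonStrict-Q-X b
                       | <ᵇ-suc-left b≢1+X | <ᵇ-suc-right b≢C = refl

  ascent-kept : ∀ a b ℓ → (a ≡ suc X → b ≡ C → ℓ ≡ true) →
    ⟦ nonStrictEdge P a b ∧ ℓ ⟧ ≡ ⟦ nonStrictEdge Q a b ∧ ℓ ⟧ + ⟦ (a ≡ᵇ suc X) ∧ (b ≡ᵇ C) ⟧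
  ascent-kept a b ℓ ℓ-1+X,C with a ≟ suc X
  ... | no a≢1+X rewrite nonStrict-same a b a≢1+X | ≢⇒≡ᵇ-false a≢1+X = sym (+-identityʳ _)
  ... | yes refl with b ≟ C
  ...   | yes refl rewrite nonStrict-P-1+X C | nonStrict-Q-1+X C | ℓ-1+X,C refl refl
                         | <⇒<ᵇ-true 1+X<C | <⇒<ᵇ-true (n<1+n C) | ≤⇒<ᵇ-false {C} ≤-refl
                         | ≡ᵇ-refl (suc X) | ≡ᵇ-refl C = refl
  ...   | no b≢C rewrite nonStrict-P-1+X b | nonStrict-Q-1+X b | <ᵇ-suc-right b≢C
                       | ≢⇒≡ᵇ-false b≢C | ≡ᵇ-refl (suc X) = sym (+-identityʳ _)

  ascent-swapped : ∀ a b ℓ → (a ≡ X → b ≡ suc X → ℓ ≡ true) →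
    (a ≡ suc X → b ≡ X → ℓ ≡ false) → (a ≡ suc X → b ≡ C → ℓ ≡ false) →
    ⟦ nonStrictEdge P a b ∧ ℓ ⟧ ≡ ⟦ nonStrictEdge Q (swapℕ X a) (swapℕ X b) ∧ ℓ ⟧ + ⟦ (a ≡ᵇ X) ∧ (b ≡ᵇ suc X) ⟧
  ascent-swapped a b ℓ ℓ-X,1+X ℓ-1+X,X ℓ-1+X,C with a ≟ X | a ≟ suc X
  ... | yes refl | _ with b ≟ suc X
  ...   | yes refl rewrite swapℕ-left X | swapℕ-right X | nonStrict-X (suc X) | nonStrict-Q-1+X X
                         | <⇒<ᵇ-true (n<1+n X) | <⇒<ᵇ-true 1+X<C | ≤⇒<ᵇ-false {suc X} (n≤1+n X)
                         | ℓ-X,1+X refl refl | ≡ᵇ-refl X = refl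
  ...   | no b≢1+X rewrite swapℕ-left X | sym (relabel-X b b≢1+X) | ≢⇒≡ᵇ-false b≢1+X
                         | ∧-zeroʳ (X ≡ᵇ X) = sym (+-identityʳ _)
  ascent-swapped a b ℓ ℓ-X,1+X ℓ-1+X,X ℓ-1+X,C | no a≢X | yes refl
    rewrite swapℕ-right X | ≢⇒≡ᵇ-false a≢X with b ≟ X | b ≟ C
  ... | yes refl | _ rewrite ℓ-1+X,X refl refl | ∧-zeroʳ (nonStrictEdge P (suc X) X)
                           | ∧-zeroʳ (nonStrictEdge Q X (swapℕ X X)) = refl
  ... | no _ | yes refl rewrite ℓ-1+X,C refl refl | ∧-zeroʳ (nonStrictEdge P (suc X) C)
                              | ∧-zeroʳ (nonStrictEdge Q X (swapℕ X C)) = refl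
  ... | no b≢X | no b≢C rewrite relabel-1+X b b≢X b≢C = sym (+-identityʳ _)
  ascent-swapped a b ℓ ℓ-X,1+X ℓ-1+X,X ℓ-1+X,C | no a≢X | no a≢1+X
    rewrite swapℕ-other a≢X a≢1+X | relabel-away a b (a≢X , a≢1+X) | ≢⇒≡ᵇ-false a≢X = sym (+-identityʳ _)

  1+X<k : suc X < k
  1+X<k = <-trans 1+X<C C<k

  X<k : X < k
  X<k = <-trans (n<1+n X) 1+X<k

  vX v1+X vC : Fin k
  vX   = fromℕ< X<k
  v1+X = fromℕ< 1+X<k
  vC   = fromℕ< C<k

  τ : Perm.Permutation k k
  τ = Perm.transpose vX v1+X

  toℕ-τ : ∀ p → toℕ (τ Perm.⟨$⟩ʳ p) ≡ swapℕ X (toℕ p)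
  toℕ-τ p with p Fin.≟ vX
  ... | yes refl rewrite toℕ-fromℕ< X<k | toℕ-fromℕ< 1+X<k = sym (swapℕ-left X)
  ... | no p≢vX with p Fin.≟ v1+X
  ...   | yes refl rewrite toℕ-fromℕ< X<k | toℕ-fromℕ< 1+X<k = sym (swapℕ-right X)
  ...   | no p≢v1+X = sym (swapℕ-other (p≢vX ∘ toℕ≡⇒≡fromℕ< X<k) (p≢v1+X ∘ toℕ≡⇒≡fromℕ< 1+X<k))

  at-vertices : ∀ {m} (κ : Vec (Fin m) k) {i j} (i<k : i < k) (j<k : j < k) {ℓ} →
    lt (lookup κ (fromℕ< i<k)) (lookup κ (fromℕ< j<k)) ≡ ℓ →
    ∀ p q → toℕ p ≡ i → toℕ q ≡ j → lt (lookup κ p) (lookup κ q) ≡ ℓ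
  at-vertices κ i<k j<k eq p q p≐i q≐j =
    subst₂ (λ p′ q′ → lt (lookup κ p′) (lookup κ q′) ≡ _)
           (sym (toℕ≡⇒≡fromℕ< i<k p≐i)) (sym (toℕ≡⇒≡fromℕ< j<k q≐j)) eq

  strict-P-vXvC : strictEdge P (toℕ vX) (toℕ vC) ≡ true
  strict-P-vXvC rewrite toℕ-fromℕ< X<k | toℕ-fromℕ< C<k = strict-P-XC

  strict-Q-v1+XvC : strictEdge Q (toℕ v1+X) (toℕ vC) ≡ true
  strict-Q-v1+XvC rewrite toℕ-fromℕ< 1+X<k | toℕ-fromℕ< C<k = strict-Q-1+XC

  away-vC : Away (toℕ vC)
  away-vC rewrite toℕ-fromℕ< C<k = >⇒≢ (<-trans (n<1+n X) 1+X<C) , >⇒≢ 1+X<C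

  module Colours {m : ℕ} where

    sw : Vec (Fin m) k → Vec (Fin m) k
    sw = swapAt X

    lookup-sw-at : ∀ κ p q → toℕ q ≡ swapℕ X (toℕ p) → lookup (sw κ) p ≡ lookup κ q
    lookup-sw-at κ p q q≐τp = lookup-swapAt X κ p q q≐τp 1+X<k

    lookup-sw-vX : ∀ κ → lookup (sw κ) vX ≡ lookup κ v1+X
    lookup-sw-vX κ = lookup-sw-at κ vX v1+X
      (trans (toℕ-fromℕ< 1+X<k) (trans (sym (swapℕ-left X)) (cong (swapℕ X) (sym (toℕ-fromℕ< X<k)))))

    lookup-sw-v1+X : ∀ κ → lookup (sw κ) v1+X ≡ lookup κ vX
    lookup-sw-v1+X κ = lookup-sw-at κ v1+X vX
      (trans (toℕ-fromℕ< X<k) (trans (sym (swapℕ-right X)) (cong (swapℕ X) (sym (toℕ-fromℕ< 1+X<k)))))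

    lookup-sw-away : ∀ κ p → Away (toℕ p) → lookup (sw κ) p ≡ lookup κ p
    lookup-sw-away κ p (p≢X , p≢1+X) = lookup-sw-at κ p p (sym (swapℕ-other p≢X p≢1+X))

    -- κ is swapped iff exactly one of κ(X), κ(X+1) is below κ(C); this test is
    -- invariant under the swap, so swapping on it is an involution.
    swapTest : Vec (Fin m) k → Bool
    swapTest κ = lt (lookup κ vX) (lookup κ vC) xor lt (lookup κ v1+X) (lookup κ vC)

    swapTest-sw : ∀ κ → swapTest (sw κ) ≡ swapTest κ
    swapTest-sw κ rewrite lookup-sw-vX κ | lookup-sw-v1+X κ | lookup-sw-away κ vC away-vC =
      xor-comm (lt (lookup κ v1+X) (lookup κ vC)) (lt (lookup κ vX) (lookup κ vC))

    φ : Vec (Fin m) k → Vec (Fin m) k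
    φ κ = if swapTest κ then sw κ else κ

    lookup-φ-away : ∀ κ p → Away (toℕ p) → lookup (φ κ) p ≡ lookup κ p
    lookup-φ-away κ p away with swapTest κ
    ... | true  = lookup-sw-away κ p away
    ... | false = refl

    lt-φ-1+X,C : ∀ κ → lt (lookup (φ κ) v1+X) (lookup (φ κ) vC) ≡ lt (lookup κ vX) (lookup κ vC)
    lt-φ-1+X,C κ with swapTest κ in test
    ... | true  rewrite lookup-sw-v1+X κ | lookup-sw-away κ vC away-vC = refl
    ... | false = sym (xor-false⇒≡ test)

    content-φ : ∀ κ → content (φ κ) ≡ content κ
    content-φ κ with swapTest κ
    ... | true  = content-swapAt X κ
    ... | false = refl

    Col-φ⁺ : ∀ κ → Col P κ → Col Q (φ κ)
    Col-φ⁺ κ H p q st with strict-Q-cases st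
    ... | inj₁ (p≐1+X , q≐C) =
      at-vertices (φ κ) 1+X<k C<k (trans (lt-φ-1+X,C κ) (H vX vC strict-P-vXvC)) p q p≐1+X q≐C
    ... | inj₂ (p-away , q-away , stP)
      rewrite lookup-φ-away κ p p-away | lookup-φ-away κ q q-away = H p q stP

    Col-φ⁻ : ∀ κ → Col Q (φ κ) → Col P κ
    Col-φ⁻ κ H p q st with strict-P-cases st
    ... | inj₁ (p≐X , q≐C) =
      at-vertices κ X<k C<k (trans (sym (lt-φ-1+X,C κ)) (H v1+X vC strict-Q-v1+XvC)) p q p≐X q≐C
    ... | inj₂ (p-away , q-away , stQ) =
      subst₂ (λ a c → lt a c ≡ true) (lookup-φ-away κ p p-away) (lookup-φ-away κ q q-away) (H p q stQ)

    isColoring-φ : ∀ κ → isColoring P κ ≡ isColoring Q (φ κ)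
    isColoring-φ κ = true⇔true⇒≡
      (Col⇒isColoring Q (φ κ) ∘ Col-φ⁺ κ ∘ isColoring⇒Col P κ)
      (Col⇒isColoring P κ ∘ Col-φ⁻ κ ∘ isColoring⇒Col Q (φ κ))

    asc-kept : ∀ κ → Col P κ → swapTest κ ≡ false → asc P κ ≡ suc (asc Q κ)
    asc-kept κ H test = begin
      asc P κ
        ≡⟨ asc-sum P κ ⟩
      ∑[ p < k ] ∑[ q < k ] ⟦ nonStrictEdge P (toℕ p) (toℕ q) ∧ lt (lookup κ p) (lookup κ q) ⟧
        ≡⟨ ∑∑-plus-point _ _ (suc X) C 1+X<k C<k (λ p q →
             ascent-kept (toℕ p) (toℕ q) _ (at-vertices κ 1+X<k C<k lt-1+X,C p q)) ⟩
      suc (∑[ p < k ] ∑[ q < k ] ⟦ nonStrictEdge Q (toℕ p) (toℕ q) ∧ lt (lookup κ p) (lookup κ q) ⟧)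
        ≡⟨ cong suc (asc-sum Q κ) ⟨
      suc (asc Q κ) ∎
      where
      open ≡-Reasoning
      lt-1+X,C : lt (lookup κ v1+X) (lookup κ vC) ≡ true
      lt-1+X,C = trans (sym (xor-false⇒≡ test)) (H vX vC strict-P-vXvC)

    -- A swapped colouring satisfies κ(X) < κ(C) ≤ κ(X+1); after relabelling X ↔ X+1
    -- it loses exactly the ascent {X , X+1}.
    asc-swapped : ∀ κ → Col P κ → swapTest κ ≡ true → asc P κ ≡ suc (asc Q (sw κ))
    asc-swapped κ H test = begin
      asc P κ
        ≡⟨ asc-sum P κ ⟩
      ∑[ p < k ] ∑[ q < k ] ⟦ nonStrictEdge P (toℕ p) (toℕ q) ∧ lt (lookup κ p) (lookup κ q) ⟧
        ≡⟨ ∑∑-plus-point _ _ X (suc X) X<k 1+X<k (λ p q →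
             ascent-swapped (toℕ p) (toℕ q) _ (at-vertices κ X<k 1+X<k lt-X,1+X p q)
               (at-vertices κ 1+X<k X<k lt-1+X,X p q) (at-vertices κ 1+X<k C<k lt-1+X,C p q)) ⟩
      suc (∑[ p < k ] ∑[ q < k ] ⟦ relabelled p q ∧ lt (lookup κ p) (lookup κ q) ⟧)
        ≡⟨ cong suc (∑∑-permute (λ p q → ⟦ relabelled p q ∧ lt (lookup κ p) (lookup κ q) ⟧) τ) ⟩
      suc (∑[ p < k ] ∑[ q < k ] ⟦ relabelled (τ′ p) (τ′ q) ∧ lt (lookup κ (τ′ p)) (lookup κ (τ′ q)) ⟧)
        ≡⟨ cong suc (sum-cong-≗ {k} λ p → sum-cong-≗ {k} λ q →
             cong₂ (λ a b → ⟦ a ∧ b ⟧) (relabel-τ p q) (cong₂ lt (lookup-τ p) (lookup-τ q))) ⟩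
      suc (∑[ p < k ] ∑[ q < k ] ⟦ nonStrictEdge Q (toℕ p) (toℕ q) ∧ lt (lookup (sw κ) p) (lookup (sw κ) q) ⟧)
        ≡⟨ cong suc (asc-sum Q (sw κ)) ⟨
      suc (asc Q (sw κ)) ∎
      where
      open ≡-Reasoning
      τ′ : Fin k → Fin k
      τ′ p = τ Perm.⟨$⟩ʳ p

      relabelled : Fin k → Fin k → Bool
      relabelled p q = nonStrictEdge Q (swapℕ X (toℕ p)) (swapℕ X (toℕ q))

      relabel-τ : ∀ p q → relabelled (τ′ p) (τ′ q) ≡ nonStrictEdge Q (toℕ p) (toℕ q)
      relabel-τ p q rewrite toℕ-τ p | toℕ-τ q
        | swapℕ-involutive X (toℕ p) | swapℕ-involutive X (toℕ q) = refl

      lookup-τ : ∀ p → lookup κ (τ′ p) ≡ lookup (sw κ) p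
      lookup-τ p = sym (lookup-sw-at κ p (τ′ p) (toℕ-τ p))

      lt-X,C : lt (lookup κ vX) (lookup κ vC) ≡ true
      lt-X,C = H vX vC strict-P-vXvC

      lt-1+X,C : lt (lookup κ v1+X) (lookup κ vC) ≡ false
      lt-1+X,C = xor-true⇒false test lt-X,C

      colour-X<1+X : toℕ (lookup κ vX) < toℕ (lookup κ v1+X)
      colour-X<1+X = <-≤-trans (<ᵇ-true⇒< {b = toℕ (lookup κ vC)} lt-X,C) (<ᵇ-false⇒≥ {b = toℕ (lookup κ vC)} lt-1+X,C)

      lt-X,1+X : lt (lookup κ vX) (lookup κ v1+X) ≡ true
      lt-X,1+X = <⇒<ᵇ-true colour-X<1+X

      lt-1+X,X : lt (lookup κ v1+X) (lookup κ vX) ≡ false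
      lt-1+X,X = ≤⇒<ᵇ-false (<⇒≤ colour-X<1+X)

    asc-φ : ∀ κ → Col P κ → asc P κ ≡ suc (asc Q (φ κ))
    asc-φ κ H with swapTest κ in test
    ... | true  = asc-swapped κ H test
    ... | false = asc-kept κ H test

    term-shift : ∀ α j κ →
      (isColoring P κ ∧ (content κ ≟v α) ∧ (asc P κ ≡ᵇ suc j)) ≡
      (isColoring Q (φ κ) ∧ (content (φ κ) ≟v α) ∧ (asc Q (φ κ) ≡ᵇ j))
    term-shift α j κ rewrite content-φ κ | sym (isColoring-φ κ) with isColoring P κ in col
    ... | false = refl
    ... | true rewrite asc-φ κ (isColoring⇒Col P κ col) = refl

    coeff-shift : ∀ α j → coeffG k P m α (suc j) ≡ coeffG k Q m α j
    coeff-shift α j = trans (countB-cong (term-shift α j) (allVecs m k))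
      (countB-swapIf m k X swapTest swapTest-sw (λ κ → isColoring Q κ ∧ (content κ ≟v α) ∧ (asc Q κ ≡ᵇ j)))

    coeff-zero : ∀ α → coeffG k P m α 0 ≡ 0
    coeff-zero α = trans (countB-cong no-term (allVecs m k)) (countB-false (allVecs m k))
      where
      no-term : ∀ κ → (isColoring P κ ∧ (content κ ≟v α) ∧ (asc P κ ≡ᵇ 0)) ≡ false
      no-term κ with isColoring P κ in col
      ... | false = refl
      ... | true rewrite asc-φ κ (isColoring⇒Col P κ col) = ∧-zeroʳ _

  G-shift : GEqQTimes k P Q
  G-shift m α = Colours.coeff-zero {m} α , Colours.coeff-shift {m} α

bounceCorners : ∀ U V W {u x z k} →
  endpoint (U ++ [ n ]) ≡ (u , x) →
  endpoint (U ++ n ∷ n ∷ V ++ [ d ]) ≡ (x , z) →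
  endpoint (U ++ n ∷ n ∷ V ++ d ∷ e ∷ W) ≡ (k , k) →
  Σ ℕ λ X → Σ ℕ λ C → x ≡ suc X × z ≡ suc C × endpoint U ≡ (u , X) ×
    endFrom (u , suc (suc X)) V ≡ (X , C) × endFrom (suc (suc X) , suc C) W ≡ (k , k)
bounceCorners U V W eU eV eW
  rewrite endFrom-++ (0 , 0) U [ n ] | endFrom-++ (0 , 0) U (n ∷ n ∷ V ++ [ d ])
        | endFrom-++ (0 , 0) U (n ∷ n ∷ V ++ d ∷ e ∷ W)
  with endFrom (0 , 0) U | eU
... | (u , X) | refl
  rewrite endFrom-++ (u , suc (suc X)) V [ d ] | endFrom-++ (u , suc (suc X)) V (d ∷ e ∷ W)
  with endFrom (u , suc (suc X)) V in V-end | eV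
... | (.X , C) | refl = X , C , refl , refl , refl , V-end , eW

theorem4p4 : ∀ (k : ℕ) (P : Path) (x z u : ℕ) (U V W : Path) →
    Schroder k P →
    (x , z) ∈ points P →
    x + 1 < z →
    OneBounce P x z u →
    BounceDecomp P x z u U n n V d e W →
    GEqQTimes k P (U ++ n ∷ n ∷ V ++ e ∷ d ∷ W)
theorem4p4 k P x z u U V W schröder _ x+1<z _ (refl , U-n-end , V-d-end)
  with bounceCorners U V W U-n-end V-d-end (Schroder.ends schröder)
... | X , C , refl , refl , U-end , V-end , W-end =
  Exchange.G-shift U V W u X C k U-end V-end W-end 1+X<C
  where
  1+X<C : suc X < C
  1+X<C = ≤-pred (subst (_< suc C) (+-comm (suc X) 1) x+1<z)
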